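{- For any Minsky machine program $P$ with $n$ registers, one can compute a regular FRACTRAN program $Q$ such that for all $x_1,\dots,x_n\in\mathbb N$, $$(1,P)\text{ terminates from }(1,[x_1;\dots;x_n])\iff Q\text{ terminates from }\mathfrak p_1\,\mathfrak q_1^{x_1}\cdots\mathfrak q_n^{x_n}.$$
   Context: Minsky machines. An instruction over $n$ registers is $\mathrm{INC}\,\alpha$ or $\mathrm{DEC}\,\alpha\,p$ with $\alpha<n$ and $p\in\mathbb N$. A machine $(s,[\iota_0;\dots;\iota_k])$ has $\iota_j$ at label $s+j$. A state is $(i,\vec v)$. If $i$ labels an instruction, one step is as follows. - $\mathrm{INC}\,\alpha$ goes to $(i+1,\vec v[\alpha\mapsto v_\alpha+1])$. - $\mathrm{DEC}\,\alpha\,p$ goes to $(i+1,\vec v[\alpha\mapsto v_\alpha-1])$ if $v_\alpha>0$, and to $(p,\vec v)$ if $v_\alpha=0$. A machine terminates from a state if, after finitely many steps, it reaches a state with program counter outside the code. FRACTRAN. A program is a list of pairs $(p,q)\in\mathbb N^2$, written $p/q$. The step relation $Q:x\succ y$ is defined inductively. - $(p/q::Q'):x\succ y$ if $qy=px$. - $(p/q::Q'):x\succ y$ if $q\nmid px$ and $Q':x\succ y$. $Q$ terminates from $s$ if some $x$ reachable from $s$ in finitely many steps admits no $y$ with $Q:x\succ y$. A program is regular if all its denominators $q$ are nonzero. $\mathfrak p_0,\mathfrak p_1,\dots$ and $\mathfrak q_0,\mathfrak q_1,\dots$ are two fixed sequences of primes, all pairwise distinct. -}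

module Defs where

open import Data.Nat using (ℕ; zero; suc; _+_; _*_; _∸_; _^_; _<_; _≤_)
open import Data.Nat.Divisibility using (_∣_)
open import Data.Nat.Primality using (Prime)
open import Data.Fin using (Fin; toℕ)
open import Data.Vec using (Vec; []; _∷_; lookup; _[_]≔_)
open import Data.List using (List; []; _∷_; length)
open import Data.List.Relation.Unary.All using (All)
open import Data.Maybe using (Maybe; just; nothing)
open import Data.Product using (_×_; _,_; Σ-syntax; ∃-syntax; proj₁; proj₂)
open import Data.Sum using (_⊎_)
open import Relation.Nullary using (¬_)
open import Relation.Binary.PropositionalEquality using (_≡_; _≢_)
open import Relation.Binary.Construct.Closure.ReflexiveTransitive using (Star)

data Instr (n : ℕ) : Set where
  INC : Fin n → Instr n
  DEC : Fin n → ℕ → Instr n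

-- A machine (s , [ι₀; …; ιₖ]) : ιⱼ sits at label s + j.
MM : ℕ → Set
MM n = ℕ × List (Instr n)

MMState : ℕ → Set
MMState n = ℕ × Vec ℕ n

nth : {A : Set} → List A → ℕ → Maybe A
nth []       _       = nothing
nth (x ∷ xs) zero    = just x
nth (x ∷ xs) (suc k) = nth xs k

data MMStep {n : ℕ} (M : MM n) : MMState n → MMState n → Set where
  inc : ∀ {i j v α} → i ≡ proj₁ M + j → nth (proj₂ M) j ≡ just (INC α) →
        MMStep M (i , v) (suc i , v [ α ]≔ suc (lookup v α))
  dec-pos : ∀ {i j v α p m} → i ≡ proj₁ M + j → nth (proj₂ M) j ≡ just (DEC α p) →
        lookup v α ≡ suc m →
        MMStep M (i , v) (suc i , v [ α ]≔ m)
  dec-zero : ∀ {i j v α p} → i ≡ proj₁ M + j → nth (proj₂ M) j ≡ just (DEC α p) →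
        lookup v α ≡ 0 →
        MMStep M (i , v) (p , v)

OutCode : {n : ℕ} → MM n → ℕ → Set
OutCode (s , l) i = i < s ⊎ s + length l ≤ i

MMTerminates : {n : ℕ} → MM n → MMState n → Set
MMTerminates M st = ∃[ st' ] (Star (MMStep M) st st' × OutCode M (proj₁ st'))

Fractran : Set
Fractran = List (ℕ × ℕ)

data FStep : Fractran → ℕ → ℕ → Set where
  here  : ∀ {p q Q x y} → q * y ≡ p * x → FStep ((p , q) ∷ Q) x y
  there : ∀ {p q Q x y} → ¬ (q ∣ p * x) → FStep Q x y → FStep ((p , q) ∷ Q) x y

FTerminates : Fractran → ℕ → Set
FTerminates Q s = ∃[ x ] (Star (FStep Q) s x × (∀ y → ¬ FStep Q x y))

Regular : Fractran → Set
Regular Q = All (λ pq → proj₂ pq ≢ 0) Q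

PrimeSeqs : (ℕ → ℕ) → (ℕ → ℕ) → Set
PrimeSeqs 𝔭 𝔮 =
  (∀ i → Prime (𝔭 i)) × (∀ i → Prime (𝔮 i)) ×
  (∀ i j → 𝔭 i ≡ 𝔭 j → i ≡ j) × (∀ i j → 𝔮 i ≡ 𝔮 j → i ≡ j) ×
  (∀ i j → 𝔭 i ≢ 𝔮 j)

qEncFrom : (ℕ → ℕ) → ℕ → {n : ℕ} → Vec ℕ n → ℕ
qEncFrom 𝔮 k []       = 1
qEncFrom 𝔮 k (x ∷ xs) = 𝔮 k ^ x * qEncFrom 𝔮 (suc k) xs

qEnc : (ℕ → ℕ) → {n : ℕ} → Vec ℕ n → ℕ
qEnc 𝔮 xs = qEncFrom 𝔮 1 xs

-- A configuration (control c, registers v) is encoded as 𝔭ᶜ c · 𝔮₁^v₁ ⋯ 𝔮ₙ^vₙ, where 𝔭ᶜ c is a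
-- 𝔭-prime recording the control state. The instruction at label i compiles to a block of fractions
-- whose denominators contain the prime of a control owned by i; on an encoded configuration every
-- other block is inactive, so one FRACTRAN step is exactly one step of the owning block. Hence the
-- program runs, in lockstep, a variant of the machine in which a failed DEC first enters an
-- intermediate control and then jumps; that variant stutters with respect to the machine, and both
-- simulations preserve termination.

module Submission where

open import Defs
open import Data.Nat using (ℕ; zero; suc; _+_; _*_; _^_; _<_; _≤_; z≤n; s≤s; ≢-nonZero; ≢-nonZero⁻¹)
open import Data.Nat.Properties
  using (suc-injective; +-identityʳ; +-suc; +-cancelˡ-≡; *-assoc; *-comm; *-identityˡ; *-cancelˡ-≡;
         m*n≡0⇒m≡0∨n≡0; *-commutativeSemigroup; even≢odd; <⇒≢; <⇒≱; ≤-reflexive; m<n⇒m<1+n;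
         m+1+n≢m; m+1+n≰m)
open import Data.Nat.Divisibility using (_∣_; divides; ∣-trans; m∣m*n; n∣m*n; ∣1⇒≡1)
open import Data.Nat.Primality using (Prime; euclidsLemma; prime⇒irreducible; prime⇒nonZero; ¬prime[1])
open import Data.Nat.Tactic.RingSolver using (solve-∀)
open import Algebra.Properties.CommutativeSemigroup *-commutativeSemigroup using (x∙yz≈y∙xz)
open import Data.Fin using (Fin; toℕ) renaming (zero to fzero; suc to fsuc)
open import Data.Fin.Properties using (toℕ-injective)
open import Data.Vec using (Vec; []; _∷_; lookup; _[_]≔_)
open import Data.Vec.Properties using ([]≔-idempotent; []≔-lookup; lookup∘update)
open import Data.List using (List; []; _∷_; length; _++_)
open import Data.List.Relation.Unary.All using (All; []; _∷_)
open import Data.List.Relation.Unary.All.Properties using (++⁺)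
open import Data.Maybe using (just)
open import Data.Product using (_×_; _,_; proj₁; proj₂; ∃-syntax; Σ-syntax)
open import Data.Sum using (_⊎_; inj₁; inj₂)
open import Data.Empty using (⊥-elim)
open import Function using (id; _∘_)
open import Relation.Nullary using (¬_)
open import Relation.Binary.PropositionalEquality
open import Relation.Binary.Construct.Closure.ReflexiveTransitive using (Star; ε; _◅_; _◅◅_; gmap; kleisliStar)
open import Function.Bundles using (_⇔_; mk⇔; Equivalence)
open import Function.Properties.Equivalence using () renaming (trans to ⇔-trans)

open Equivalence using (to; from)

Halts : {A : Set} → (A → A → Set) → A → Set
Halts R x = ∀ y → ¬ R x y

Terminates : {A : Set} → (A → A → Set) → A → Set
Terminates R x = ∃[ z ] (Star R x z × Halts R z)

module _ {A B : Set} {S : A → A → Set} {T : B → B → Set} (⌜_⌝ : A → B)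
         (sound : ∀ {a a'} → S a a' → T ⌜ a ⌝ ⌜ a' ⌝)
         (complete : ∀ {a y} → T ⌜ a ⌝ y → ∃[ a' ] (S a a' × y ≡ ⌜ a' ⌝)) where

  Star-complete : ∀ {a z} → Star T ⌜ a ⌝ z → ∃[ a' ] (Star S a a' × z ≡ ⌜ a' ⌝)
  Star-complete ε = _ , ε , refl
  Star-complete (t ◅ ts) with complete t
  ... | _ , s , refl with Star-complete ts
  ...   | a' , ss , z≡ = a' , s ◅ ss , z≡

  terminates-transfer : ∀ a → Terminates S a ⇔ Terminates T ⌜ a ⌝
  terminates-transfer a = mk⇔ forth back
    where
    forth : Terminates S a → Terminates T ⌜ a ⌝
    forth (z , run , halts) =
      ⌜ z ⌝ , gmap ⌜_⌝ sound run , λ y t → halts _ (proj₁ (proj₂ (complete t)))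
    back : Terminates T ⌜ a ⌝ → Terminates S a
    back (z , run , halts) with Star-complete run
    ... | a' , run' , refl = a' , run' , λ a'' s → halts _ (sound s)

prime∤1 : ∀ {p} → Prime p → ¬ p ∣ 1
prime∤1 pp p∣1 = ¬prime[1] (subst Prime (∣1⇒≡1 p∣1) pp)

prime≢0 : ∀ {p} → Prime p → p ≢ 0
prime≢0 pp = ≢-nonZero⁻¹ _ {{prime⇒nonZero pp}}

prime∣prime⇒≡ : ∀ {p q} → Prime p → Prime q → p ∣ q → p ≡ q
prime∣prime⇒≡ pp pq p∣q with prime⇒irreducible pq p∣q
... | inj₁ p≡1 = ⊥-elim (¬prime[1] (subst Prime p≡1 pp))
... | inj₂ p≡q = p≡q

prime∣^⇒∣ : ∀ {p} m k → Prime p → p ∣ m ^ k → p ∣ m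
prime∣^⇒∣ m zero    pp p∣1 = ⊥-elim (prime∤1 pp p∣1)
prime∣^⇒∣ m (suc k) pp p∣m^[1+k] with euclidsLemma m (m ^ k) pp p∣m^[1+k]
... | inj₁ p∣m   = p∣m
... | inj₂ p∣m^k = prime∣^⇒∣ m k pp p∣m^k

*-pres-≢0 : ∀ {m n} → m ≢ 0 → n ≢ 0 → m * n ≢ 0
*-pres-≢0 {m} m≢0 n≢0 mn≡0 with m*n≡0⇒m≡0∨n≡0 m mn≡0
... | inj₁ m≡0 = m≢0 m≡0
... | inj₂ n≡0 = n≢0 n≡0

[m*n]*[o*[p*q]]≡[o*p]*[m*[n*q]] : ∀ m n o p q → (m * n) * (o * (p * q)) ≡ (o * p) * (m * (n * q))
[m*n]*[o*[p*q]]≡[o*p]*[m*[n*q]] = solve-∀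

Inactive : ℕ → ℕ × ℕ → Set
Inactive x (p , q) = ¬ q ∣ p * x

m*n≡o⇒m∣o : ∀ {q y m} → q * y ≡ m → q ∣ m
m*n≡o⇒m∣o {q} {y} eq = divides y (trans (sym eq) (*-comm q y))

FStep-skip⇔ : ∀ {pq Q x y} → Inactive x pq → FStep (pq ∷ Q) x y ⇔ FStep Q x y
FStep-skip⇔ {p , q} {Q} {x} {y} ina = mk⇔ forth (there ina)
  where
  forth : FStep ((p , q) ∷ Q) x y → FStep Q x y
  forth (here eq)    = ⊥-elim (ina (m*n≡o⇒m∣o eq))
  forth (there _ st) = st

¬FStep-inactive : ∀ {Q x y} → All (Inactive x) Q → ¬ FStep Q x y
¬FStep-inactive (ina ∷ _)    (here eq)    = ina (m*n≡o⇒m∣o eq)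
¬FStep-inactive (_   ∷ inas) (there _ st) = ¬FStep-inactive inas st

FStep-++-inactiveˡ : ∀ {L R x y} → All (Inactive x) L → FStep (L ++ R) x y ⇔ FStep R x y
FStep-++-inactiveˡ []           = mk⇔ id id
FStep-++-inactiveˡ (ina ∷ inas) = ⇔-trans (FStep-skip⇔ ina) (FStep-++-inactiveˡ inas)

FStep-++-inactiveʳ : ∀ L {R x y} → All (Inactive x) R → FStep (L ++ R) x y ⇔ FStep L x y
FStep-++-inactiveʳ []      inas = mk⇔ (λ st → ⊥-elim (¬FStep-inactive inas st)) λ ()
FStep-++-inactiveʳ (_ ∷ L) inas = mk⇔
  (λ { (here eq) → here eq ; (there ina st) → there ina (to (FStep-++-inactiveʳ L inas) st) })
  (λ { (here eq) → here eq ; (there ina st) → there ina (from (FStep-++-inactiveʳ L inas) st) })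

FStep-head⇔ : ∀ {p q Q x y y₀} → q ≢ 0 → q * y₀ ≡ p * x → FStep ((p , q) ∷ Q) x y ⇔ y ≡ y₀
FStep-head⇔ {p} {q} {Q} {x} {y} {y₀} q≢0 eq₀ = mk⇔ forth λ { refl → here eq₀ }
  where
  forth : FStep ((p , q) ∷ Q) x y → y ≡ y₀
  forth (here eq)     = *-cancelˡ-≡ y y₀ q {{≢-nonZero q≢0}} (trans eq (sym eq₀))
  forth (there ina _) = ⊥-elim (ina (m*n≡o⇒m∣o eq₀))

nth-just⇒< : ∀ {A : Set} (l : List A) j {a} → nth l j ≡ just a → j < length l
nth-just⇒< (_ ∷ _) zero    _  = s≤s z≤n
nth-just⇒< (_ ∷ l) (suc j) nt = s≤s (nth-just⇒< l j nt)

nth-just⊎length≤ : ∀ {A : Set} (l : List A) j → (∃[ a ] nth l j ≡ just a) ⊎ length l ≤ j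
nth-just⊎length≤ []      _       = inj₂ z≤n
nth-just⊎length≤ (a ∷ _) zero    = inj₁ (a , refl)
nth-just⊎length≤ (_ ∷ l) (suc j) with nth-just⊎length≤ l j
... | inj₁ found = inj₁ found
... | inj₂ l≤j   = inj₂ (s≤s l≤j)

OutCode-∷ : ∀ {n i s ι} {ιs : List (Instr n)} → OutCode (s , ι ∷ ιs) i → i ≢ s × OutCode (suc s , ιs) i
OutCode-∷ (inj₁ i<s) = <⇒≢ i<s , inj₁ (m<n⇒m<1+n i<s)
OutCode-∷ {i = i} {s} {ιs = ιs} (inj₂ s+1+len≤i) =
  (λ { refl → m+1+n≰m s s+1+len≤i }) , inj₂ (subst (_≤ i) (+-suc s (length ιs)) s+1+len≤i)

OutCode⇒nth≢just : ∀ {n j ι} (P : List (Instr n)) → OutCode (1 , P) (suc j) → nth P j ≢ just ι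
OutCode⇒nth≢just P (inj₁ (s≤s ()))
OutCode⇒nth≢just {j = j} P (inj₂ (s≤s len≤j)) nt = <⇒≱ (nth-just⇒< P j nt) len≤j

OutCode⊎nth≡just : ∀ {n} (P : List (Instr n)) i →
  OutCode (1 , P) i ⊎ ∃[ j ] (i ≡ suc j × ∃[ ι ] nth P j ≡ just ι)
OutCode⊎nth≡just P zero = inj₁ (inj₁ (s≤s z≤n))
OutCode⊎nth≡just P (suc j) with nth-just⊎length≤ P j
... | inj₁ found   = inj₂ (j , refl , found)
... | inj₂ len≤j   = inj₁ (inj₂ (s≤s len≤j))

-- jumping i: the instruction DEC α p at label i found register α empty and is about to jump to p.
data Control : Set where
  at      : ℕ → Control
  jumping : ℕ → Control

owner : Control → ℕ
owner (at i)      = i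
owner (jumping i) = i

owner-≢ : ∀ {c d} → owner c ≢ owner d → d ≢ c
owner-≢ o≢ d≡c = o≢ (cong owner (sym d≡c))

-- at 1 gets index 1, so that the start label 1 is encoded by 𝔭₁.
ctrlIndex : Control → ℕ
ctrlIndex (at zero)    = 0
ctrlIndex (at (suc i)) = suc (2 * i)
ctrlIndex (jumping i)  = 2 * suc i

ctrlIndex-injective : ∀ {c d} → ctrlIndex c ≡ ctrlIndex d → c ≡ d
ctrlIndex-injective {at zero}    {at zero}    _ = refl
ctrlIndex-injective {at (suc i)} {at (suc j)} e = cong (at ∘ suc) (*-cancelˡ-≡ i j 2 (suc-injective e))
ctrlIndex-injective {at (suc i)} {jumping j}  e = ⊥-elim (even≢odd (suc j) i (sym e))
ctrlIndex-injective {jumping i}  {at (suc j)} e = ⊥-elim (even≢odd (suc i) j e)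
ctrlIndex-injective {jumping i}  {jumping j}  e = cong jumping (suc-injective (*-cancelˡ-≡ (suc i) (suc j) 2 e))

qEncFrom-inc : ∀ (𝔮 : ℕ → ℕ) k {m} (v : Vec ℕ m) α →
  qEncFrom 𝔮 k (v [ α ]≔ suc (lookup v α)) ≡ 𝔮 (k + toℕ α) * qEncFrom 𝔮 k v
qEncFrom-inc 𝔮 k (x ∷ xs) fzero rewrite +-identityʳ k = *-assoc (𝔮 k) (𝔮 k ^ x) _
qEncFrom-inc 𝔮 k (x ∷ xs) (fsuc α) rewrite qEncFrom-inc 𝔮 (suc k) xs α | +-suc k (toℕ α) =
  x∙yz≈y∙xz (𝔮 k ^ x) (𝔮 (suc k + toℕ α)) _

qEncFrom-dec : ∀ (𝔮 : ℕ → ℕ) k {m} (v : Vec ℕ m) α {r} → lookup v α ≡ suc r →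
  qEncFrom 𝔮 k v ≡ 𝔮 (k + toℕ α) * qEncFrom 𝔮 k (v [ α ]≔ r)
qEncFrom-dec 𝔮 k v α {r} lk = trans (cong (qEncFrom 𝔮 k) restored) (qEncFrom-inc 𝔮 k (v [ α ]≔ r) α)
  where
  open ≡-Reasoning
  restored : v ≡ (v [ α ]≔ r) [ α ]≔ suc (lookup (v [ α ]≔ r) α)
  restored = begin
    v                                               ≡⟨ []≔-lookup v α ⟨
    v [ α ]≔ lookup v α                             ≡⟨ cong (v [ α ]≔_) lk ⟩
    v [ α ]≔ suc r                                  ≡⟨ []≔-idempotent v α ⟨
    (v [ α ]≔ r) [ α ]≔ suc r                       ≡⟨ cong (λ x → (v [ α ]≔ r) [ α ]≔ suc x) (lookup∘update α v r) ⟨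
    (v [ α ]≔ r) [ α ]≔ suc (lookup (v [ α ]≔ r) α) ∎

module Simulation (𝔭 𝔮 : ℕ → ℕ) (ps : PrimeSeqs 𝔭 𝔮) where

  𝔭-prime : ∀ i → Prime (𝔭 i)
  𝔭-prime = proj₁ ps

  𝔮-prime : ∀ i → Prime (𝔮 i)
  𝔮-prime = proj₁ (proj₂ ps)

  𝔭-injective : ∀ i j → 𝔭 i ≡ 𝔭 j → i ≡ j
  𝔭-injective = proj₁ (proj₂ (proj₂ ps))

  𝔮-injective : ∀ i j → 𝔮 i ≡ 𝔮 j → i ≡ j
  𝔮-injective = proj₁ (proj₂ (proj₂ (proj₂ ps)))

  𝔭≢𝔮 : ∀ i j → 𝔭 i ≢ 𝔮 j
  𝔭≢𝔮 = proj₂ (proj₂ (proj₂ (proj₂ ps)))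

  𝔭-Free : ℕ → Set
  𝔭-Free m = ∀ k → ¬ 𝔭 k ∣ m

  𝔭-Free-1 : 𝔭-Free 1
  𝔭-Free-1 k = prime∤1 (𝔭-prime k)

  𝔭-Free-* : ∀ {m n} → 𝔭-Free m → 𝔭-Free n → 𝔭-Free (m * n)
  𝔭-Free-* {m} {n} fm fn k 𝔭∣mn with euclidsLemma m n (𝔭-prime k) 𝔭∣mn
  ... | inj₁ 𝔭∣m = fm k 𝔭∣m
  ... | inj₂ 𝔭∣n = fn k 𝔭∣n

  𝔭-Free-𝔮 : ∀ j → 𝔭-Free (𝔮 j)
  𝔭-Free-𝔮 j k 𝔭∣𝔮 = 𝔭≢𝔮 k j (prime∣prime⇒≡ (𝔭-prime k) (𝔮-prime j) 𝔭∣𝔮)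

  𝔭-Free-qEncFrom : ∀ k {m} (v : Vec ℕ m) → 𝔭-Free (qEncFrom 𝔮 k v)
  𝔭-Free-qEncFrom k []       = 𝔭-Free-1
  𝔭-Free-qEncFrom k (x ∷ xs) =
    𝔭-Free-* (λ l 𝔭∣𝔮^x → 𝔭-Free-𝔮 k l (prime∣^⇒∣ (𝔮 k) x (𝔭-prime l) 𝔭∣𝔮^x)) (𝔭-Free-qEncFrom (suc k) xs)

  𝔭∣𝔭*⇒≡ : ∀ {c d R} → 𝔭-Free R → 𝔭 d ∣ 𝔭 c * R → d ≡ c
  𝔭∣𝔭*⇒≡ {c} {d} {R} fR 𝔭∣𝔭R with euclidsLemma (𝔭 c) R (𝔭-prime d) 𝔭∣𝔭R
  ... | inj₁ 𝔭∣𝔭 = 𝔭-injective d c (prime∣prime⇒≡ (𝔭-prime d) (𝔭-prime c) 𝔭∣𝔭)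
  ... | inj₂ 𝔭∣R = ⊥-elim (fR d 𝔭∣R)

  𝔮∤⇒𝔮∤𝔭* : ∀ {t k R} → ¬ 𝔮 t ∣ R → ¬ 𝔮 t ∣ 𝔭 k * R
  𝔮∤⇒𝔮∤𝔭* {t} {k} {R} 𝔮∤R 𝔮∣𝔭R with euclidsLemma (𝔭 k) R (𝔮-prime t) 𝔮∣𝔭R
  ... | inj₁ 𝔮∣𝔭 = 𝔭≢𝔮 k t (sym (prime∣prime⇒≡ (𝔮-prime t) (𝔭-prime k) 𝔮∣𝔭))
  ... | inj₂ 𝔮∣R = 𝔮∤R 𝔮∣R

  𝔮∣𝔮^⇒≡ : ∀ {t k} x → 𝔮 t ∣ 𝔮 k ^ x → t ≡ k
  𝔮∣𝔮^⇒≡ {t} {k} x 𝔮∣𝔮^x =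
    𝔮-injective t k (prime∣prime⇒≡ (𝔮-prime t) (𝔮-prime k) (prime∣^⇒∣ (𝔮 k) x (𝔮-prime t) 𝔮∣𝔮^x))

  𝔮∣qEncFrom⇒nonempty : ∀ k {m} (v : Vec ℕ m) t → 𝔮 t ∣ qEncFrom 𝔮 k v →
    ∃[ α ] (k + toℕ α ≡ t × lookup v α ≢ 0)
  𝔮∣qEncFrom⇒nonempty k []       t 𝔮∣1 = ⊥-elim (prime∤1 (𝔮-prime t) 𝔮∣1)
  𝔮∣qEncFrom⇒nonempty k (x ∷ xs) t 𝔮∣enc
    with euclidsLemma (𝔮 k ^ x) (qEncFrom 𝔮 (suc k) xs) (𝔮-prime t) 𝔮∣enc
  ... | inj₁ 𝔮∣𝔮^x =
    fzero , trans (+-identityʳ k) (sym (𝔮∣𝔮^⇒≡ x 𝔮∣𝔮^x)) ,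
    λ x≡0 → prime∤1 (𝔮-prime t) (subst (λ e → 𝔮 t ∣ 𝔮 k ^ e) x≡0 𝔮∣𝔮^x)
  ... | inj₂ 𝔮∣rest with 𝔮∣qEncFrom⇒nonempty (suc k) xs t 𝔮∣rest
  ...   | α , k+1+α≡t , nonempty = fsuc α , trans (+-suc k (toℕ α)) k+1+α≡t , nonempty

  𝔮∤qEncFrom-empty : ∀ k {m} (v : Vec ℕ m) α → lookup v α ≡ 0 → ¬ 𝔮 (k + toℕ α) ∣ qEncFrom 𝔮 k v
  𝔮∤qEncFrom-empty k v α empty 𝔮∣enc with 𝔮∣qEncFrom⇒nonempty k v _ 𝔮∣enc
  ... | β , k+β≡k+α , nonempty =
    nonempty (subst (λ γ → lookup v γ ≡ 0) (sym (toℕ-injective (+-cancelˡ-≡ k _ _ k+β≡k+α))) empty)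

  𝔭ᶜ : Control → ℕ
  𝔭ᶜ c = 𝔭 (ctrlIndex c)

  move : Control → ℕ → Control → ℕ → ℕ × ℕ
  move c b c' a = 𝔭ᶜ c' * a , 𝔭ᶜ c * b

  move-regular : ∀ c {b} → b ≢ 0 → 𝔭ᶜ c * b ≢ 0
  move-regular c b≢0 = *-pres-≢0 (prime≢0 (𝔭-prime _)) b≢0

  move-inactive : ∀ c d c' {a b R} → d ≢ c → d ≢ c' → 𝔭-Free a → 𝔭-Free R →
    Inactive (𝔭ᶜ c * R) (move d b c' a)
  move-inactive c d c' {a} {b} {R} d≢c d≢c' fa fR 𝔭b∣
    with euclidsLemma (𝔭ᶜ c' * a) (𝔭ᶜ c * R) (𝔭-prime (ctrlIndex d)) (∣-trans (m∣m*n b) 𝔭b∣)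
  ... | inj₁ 𝔭∣𝔭a = d≢c' (ctrlIndex-injective (𝔭∣𝔭*⇒≡ fa 𝔭∣𝔭a))
  ... | inj₂ 𝔭∣𝔭R = d≢c  (ctrlIndex-injective (𝔭∣𝔭*⇒≡ fR 𝔭∣𝔭R))

  move-inactive-𝔮∤ : ∀ c c' {t R} → ¬ 𝔮 t ∣ R → Inactive (𝔭ᶜ c * R) (move c (𝔮 t) c' 1)
  move-inactive-𝔮∤ c c' {t} {R} 𝔮∤R 𝔭𝔮∣
    with euclidsLemma (𝔭ᶜ c' * 1) (𝔭ᶜ c * R) (𝔮-prime t) (∣-trans (n∣m*n (𝔭ᶜ c)) 𝔭𝔮∣)
  ... | inj₁ 𝔮∣𝔭 = 𝔮∤⇒𝔮∤𝔭* (prime∤1 (𝔮-prime t)) 𝔮∣𝔭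
  ... | inj₂ 𝔮∣𝔭R = 𝔮∤⇒𝔮∤𝔭* 𝔮∤R 𝔮∣𝔭R

  move-step⇔ : ∀ c c' {a b R S T Q y} → b ≢ 0 → b * R ≡ S → a * R ≡ T →
    FStep (move c b c' a ∷ Q) (𝔭ᶜ c * S) y ⇔ y ≡ 𝔭ᶜ c' * T
  move-step⇔ c c' {a} {b} {R} b≢0 refl refl =
    FStep-head⇔ (move-regular c b≢0) ([m*n]*[o*[p*q]]≡[o*p]*[m*[n*q]] (𝔭ᶜ c) b (𝔭ᶜ c') a R)

  register : ∀ {n} → Fin n → ℕ
  register α = 𝔮 (suc (toℕ α))

  register≢0 : ∀ {n} {α : Fin n} → register α ≢ 0
  register≢0 = prime≢0 (𝔮-prime _)

  -- DEC jumps through jumping i: a fraction 𝔭ᶜ (at p) / 𝔭ᶜ (at i) with p ≡ i would divide every number.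
  block : ∀ {n} → ℕ → Instr n → Fractran
  block i (INC α)   = move (at i) 1 (at (suc i)) (register α) ∷ []
  block i (DEC α p) = move (at i) (register α) (at (suc i)) 1
                    ∷ move (at i) 1 (jumping i) 1
                    ∷ move (jumping i) 1 (at p) 1
                    ∷ []

  compileFrom : ∀ {n} → ℕ → List (Instr n) → Fractran
  compileFrom i []       = []
  compileFrom i (ι ∷ ιs) = block i ι ++ compileFrom (suc i) ιs

  block-regular : ∀ {n} i (ι : Instr n) → Regular (block i ι)
  block-regular i (INC α)   = move-regular (at i) (λ ()) ∷ []
  block-regular i (DEC α p) =
    move-regular (at i) register≢0 ∷ move-regular (at i) (λ ()) ∷ move-regular (jumping i) (λ ()) ∷ []

  compileFrom-regular : ∀ {n} i (ιs : List (Instr n)) → Regular (compileFrom i ιs)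
  compileFrom-regular i []       = []
  compileFrom-regular i (ι ∷ ιs) = ++⁺ (block-regular i ι) (compileFrom-regular (suc i) ιs)

  block-inactive : ∀ {n R} c i (ι : Instr n) → owner c ≢ i → 𝔭-Free R →
    All (Inactive (𝔭ᶜ c * R)) (block i ι)
  block-inactive c i (INC α) c∉i fR =
    move-inactive c (at i) (at (suc i)) (owner-≢ c∉i) (λ ()) (𝔭-Free-𝔮 _) fR ∷ []
  block-inactive c i (DEC α p) c∉i fR =
    move-inactive c (at i) (at (suc i)) (owner-≢ c∉i) (λ ()) 𝔭-Free-1 fR ∷
    move-inactive c (at i) (jumping i) (owner-≢ c∉i) (λ ()) 𝔭-Free-1 fR ∷
    move-inactive c (jumping i) (at p) (owner-≢ c∉i) (λ ()) 𝔭-Free-1 fR ∷ []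

  compileFrom-inactive : ∀ {n R} c s (ιs : List (Instr n)) → OutCode (s , ιs) (owner c) → 𝔭-Free R →
    All (Inactive (𝔭ᶜ c * R)) (compileFrom s ιs)
  compileFrom-inactive c s []       _   _  = []
  compileFrom-inactive c s (ι ∷ ιs) out fR with OutCode-∷ {ι = ι} {ιs} out
  ... | c∉s , out' = ++⁺ (block-inactive c s ι c∉s fR) (compileFrom-inactive c (suc s) ιs out' fR)

  compileFrom-focus : ∀ {n R y ι} c s (ιs : List (Instr n)) j →
    nth ιs j ≡ just ι → owner c ≡ s + j → 𝔭-Free R →
    FStep (compileFrom s ιs) (𝔭ᶜ c * R) y ⇔ FStep (block (owner c) ι) (𝔭ᶜ c * R) y
  compileFrom-focus c s (ι ∷ ιs) zero refl c∈s fR rewrite c∈s | +-identityʳ s =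
    FStep-++-inactiveʳ (block s ι)
      (compileFrom-inactive c (suc s) ιs (inj₁ (s≤s (≤-reflexive c∈s))) fR)
  compileFrom-focus c s (ι' ∷ ιs) (suc j) nt c∈s+1+j fR =
    ⇔-trans (FStep-++-inactiveˡ (block-inactive c s ι' (λ c∈s → m+1+n≢m s (trans (sym c∈s+1+j) c∈s)) fR))
            (compileFrom-focus c (suc s) ιs j nt (trans c∈s+1+j (+-suc s j)) fR)

  Config : ℕ → Set
  Config n = Control × Vec ℕ n

  encode : ∀ {n} → Config n → ℕ
  encode (c , v) = 𝔭ᶜ c * qEnc 𝔮 v

  block-inc⇔ : ∀ {n y} i (v : Vec ℕ n) (α : Fin n) →
    FStep (block i (INC α)) (encode (at i , v)) y ⇔ y ≡ encode (at (suc i) , v [ α ]≔ suc (lookup v α))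
  block-inc⇔ i v α = move-step⇔ (at i) (at (suc i)) (λ ()) (*-identityˡ _) (sym (qEncFrom-inc 𝔮 1 v α))

  block-dec-pos⇔ : ∀ {n r y} i p (v : Vec ℕ n) (α : Fin n) → lookup v α ≡ suc r →
    FStep (block i (DEC α p)) (encode (at i , v)) y ⇔ y ≡ encode (at (suc i) , v [ α ]≔ r)
  block-dec-pos⇔ i p v α lk =
    move-step⇔ (at i) (at (suc i)) register≢0 (sym (qEncFrom-dec 𝔮 1 v α lk)) (*-identityˡ _)

  block-dec-zero⇔ : ∀ {n y} i p (v : Vec ℕ n) (α : Fin n) → lookup v α ≡ 0 →
    FStep (block i (DEC α p)) (encode (at i , v)) y ⇔ y ≡ encode (jumping i , v)
  block-dec-zero⇔ i p v α empty = ⇔-trans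
    (FStep-skip⇔ (move-inactive-𝔮∤ (at i) (at (suc i)) (𝔮∤qEncFrom-empty 1 v α empty)))
    (move-step⇔ (at i) (jumping i) (λ ()) (*-identityˡ _) (*-identityˡ _))

  block-jump⇔ : ∀ {n y} i p (v : Vec ℕ n) (α : Fin n) →
    FStep (block i (DEC α p)) (encode (jumping i , v)) y ⇔ y ≡ encode (at p , v)
  block-jump⇔ i p v α = ⇔-trans
    (FStep-skip⇔ (move-inactive (jumping i) (at i) (at (suc i)) (λ ()) (λ ()) 𝔭-Free-1 𝔭-free-v))
    (⇔-trans (FStep-skip⇔ (move-inactive (jumping i) (at i) (jumping i) (λ ()) (λ ()) 𝔭-Free-1 𝔭-free-v))
             (move-step⇔ (jumping i) (at p) (λ ()) (*-identityˡ _) (*-identityˡ _)))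
    where
    𝔭-free-v : 𝔭-Free (qEnc 𝔮 v)
    𝔭-free-v = 𝔭-Free-qEncFrom 1 v

  block-inc-jumping : ∀ {n y} i (v : Vec ℕ n) (α : Fin n) →
    ¬ FStep (block i (INC α)) (encode (jumping i , v)) y
  block-inc-jumping i v α = ¬FStep-inactive
    (move-inactive (jumping i) (at i) (at (suc i)) (λ ()) (λ ()) (𝔭-Free-𝔮 _) (𝔭-Free-qEncFrom 1 v) ∷ [])

  module Machine {n : ℕ} (P : List (Instr n)) where

    data ConfigStep : Config n → Config n → Set where
      inc      : ∀ {j v α} → nth P j ≡ just (INC α) →
                 ConfigStep (at (suc j) , v) (at (suc (suc j)) , v [ α ]≔ suc (lookup v α))
      dec-pos  : ∀ {j v α p r} → nth P j ≡ just (DEC α p) → lookup v α ≡ suc r →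
                 ConfigStep (at (suc j) , v) (at (suc (suc j)) , v [ α ]≔ r)
      dec-zero : ∀ {j v α p} → nth P j ≡ just (DEC α p) → lookup v α ≡ 0 →
                 ConfigStep (at (suc j) , v) (jumping (suc j) , v)
      jump     : ∀ {j v α p} → nth P j ≡ just (DEC α p) →
                 ConfigStep (jumping (suc j) , v) (at p , v)

    compile : Fractran
    compile = compileFrom 1 P

    compile-focus : ∀ {y j ι} c (v : Vec ℕ n) → nth P j ≡ just ι → owner c ≡ suc j →
      FStep compile (encode (c , v)) y ⇔ FStep (block (owner c) ι) (encode (c , v)) y
    compile-focus {j = j} c v nt c∈j = compileFrom-focus c 1 P j nt c∈j (𝔭-Free-qEncFrom 1 v)

    compile-stuck : ∀ {y} c (v : Vec ℕ n) → OutCode (1 , P) (owner c) → ¬ FStep compile (encode (c , v)) y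
    compile-stuck c v out = ¬FStep-inactive (compileFrom-inactive c 1 P out (𝔭-Free-qEncFrom 1 v))

    ConfigStep⇒FStep : ∀ {κ κ'} → ConfigStep κ κ' → FStep compile (encode κ) (encode κ')
    ConfigStep⇒FStep (inc {j} {v} {α} nt) =
      from (compile-focus (at (suc j)) v nt refl) (from (block-inc⇔ (suc j) v α) refl)
    ConfigStep⇒FStep (dec-pos {j} {v} {α} {p} nt lk) =
      from (compile-focus (at (suc j)) v nt refl) (from (block-dec-pos⇔ (suc j) p v α lk) refl)
    ConfigStep⇒FStep (dec-zero {j} {v} {α} {p} nt empty) =
      from (compile-focus (at (suc j)) v nt refl) (from (block-dec-zero⇔ (suc j) p v α empty) refl)
    ConfigStep⇒FStep (jump {j} {v} {α} {p} nt) =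
      from (compile-focus (jumping (suc j)) v nt refl) (from (block-jump⇔ (suc j) p v α) refl)

    block⇒ConfigStep : ∀ {y j} c v ι → nth P j ≡ just ι → owner c ≡ suc j →
      FStep (block (owner c) ι) (encode (c , v)) y → ∃[ κ' ] (ConfigStep (c , v) κ' × y ≡ encode κ')
    block⇒ConfigStep (at i) v (INC α) nt refl st = _ , inc nt , to (block-inc⇔ i v α) st
    block⇒ConfigStep (at i) v (DEC α p) nt refl st with lookup v α in lk
    ... | suc r = _ , dec-pos nt lk , to (block-dec-pos⇔ i p v α lk) st
    ... | zero  = _ , dec-zero nt lk , to (block-dec-zero⇔ i p v α lk) st
    block⇒ConfigStep (jumping i) v (INC α)   nt refl st = ⊥-elim (block-inc-jumping i v α st)
    block⇒ConfigStep (jumping i) v (DEC α p) nt refl st = _ , jump nt , to (block-jump⇔ i p v α) st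

    FStep⇒ConfigStep : ∀ {κ y} → FStep compile (encode κ) y → ∃[ κ' ] (ConfigStep κ κ' × y ≡ encode κ')
    FStep⇒ConfigStep {c , v} st with OutCode⊎nth≡just P (owner c)
    ... | inj₁ out                = ⊥-elim (compile-stuck c v out st)
    ... | inj₂ (j , c∈j , ι , nt) = block⇒ConfigStep c v ι nt c∈j (to (compile-focus c v nt c∈j) st)

    Terminates⇔FTerminates : ∀ κ → Terminates ConfigStep κ ⇔ FTerminates compile (encode κ)
    Terminates⇔FTerminates = terminates-transfer encode ConfigStep⇒FStep FStep⇒ConfigStep

    atConfig : MMState n → Config n
    atConfig (i , v) = at i , v

    MMStep⇒ConfigStep⋆ : ∀ {st st'} → MMStep (1 , P) st st' → Star ConfigStep (atConfig st) (atConfig st')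
    MMStep⇒ConfigStep⋆ (inc refl nt)            = inc nt ◅ ε
    MMStep⇒ConfigStep⋆ (dec-pos refl nt lk)     = dec-pos nt lk ◅ ε
    MMStep⇒ConfigStep⋆ (dec-zero refl nt empty) = dec-zero nt empty ◅ jump nt ◅ ε

    OutCode⇒halts : ∀ {i v} → OutCode (1 , P) i → Halts ConfigStep (at i , v)
    OutCode⇒halts out _ (inc nt)         = OutCode⇒nth≢just P out nt
    OutCode⇒halts out _ (dec-pos nt _)   = OutCode⇒nth≢just P out nt
    OutCode⇒halts out _ (dec-zero nt _)  = OutCode⇒nth≢just P out nt

    progress : ∀ {j ι} v → nth P j ≡ just ι → ∃[ κ' ] ConfigStep (at (suc j) , v) κ'
    progress {ι = INC α}   v nt = _ , inc nt
    progress {ι = DEC α p} v nt with lookup v α in lk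
    ... | zero  = _ , dec-zero nt lk
    ... | suc r = _ , dec-pos nt lk

    data Tracks : Config n → MMState n → Set where
      at~      : ∀ {i v} → Tracks (at i , v) (i , v)
      jumping~ : ∀ {j v α p} → nth P j ≡ just (DEC α p) → Tracks (jumping (suc j) , v) (p , v)

    ConfigStep⇒MMStep⋆ : ∀ {κ κ' st} → Tracks κ st → ConfigStep κ κ' →
      ∃[ st' ] (Star (MMStep (1 , P)) st st' × Tracks κ' st')
    ConfigStep⇒MMStep⋆ at~ (inc nt)            = _ , inc refl nt ◅ ε , at~
    ConfigStep⇒MMStep⋆ at~ (dec-pos nt lk)     = _ , dec-pos refl nt lk ◅ ε , at~
    ConfigStep⇒MMStep⋆ at~ (dec-zero nt empty) = _ , dec-zero refl nt empty ◅ ε , jumping~ nt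
    ConfigStep⇒MMStep⋆ (jumping~ nt) (jump nt') with trans (sym nt) nt'
    ... | refl = _ , ε , at~

    Star-tracks : ∀ {κ κ' st} → Tracks κ st → Star ConfigStep κ κ' →
      ∃[ st' ] (Star (MMStep (1 , P)) st st' × Tracks κ' st')
    Star-tracks tr ε = _ , ε , tr
    Star-tracks tr (s ◅ ss) with ConfigStep⇒MMStep⋆ tr s
    ... | _ , run , tr' with Star-tracks tr' ss
    ...   | st' , run' , tr'' = st' , run ◅◅ run' , tr''

    halts⇒OutCode : ∀ {κ st} → Tracks κ st → Halts ConfigStep κ → OutCode (1 , P) (proj₁ st)
    halts⇒OutCode (at~ {i} {v}) halts with OutCode⊎nth≡just P i
    ... | inj₁ out                = out
    ... | inj₂ (_ , refl , _ , nt) = ⊥-elim (halts _ (proj₂ (progress v nt)))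
    halts⇒OutCode (jumping~ nt) halts = ⊥-elim (halts _ (jump nt))

    MMTerminates⇔Terminates : ∀ st → MMTerminates (1 , P) st ⇔ Terminates ConfigStep (atConfig st)
    MMTerminates⇔Terminates (i , v) = mk⇔ forth back
      where
      forth : MMTerminates (1 , P) (i , v) → Terminates ConfigStep (at i , v)
      forth ((i' , v') , run , out) =
        (at i' , v') , kleisliStar atConfig MMStep⇒ConfigStep⋆ run , OutCode⇒halts out
      back : Terminates ConfigStep (at i , v) → MMTerminates (1 , P) (i , v)
      back (_ , run , halts) with Star-tracks at~ run
      ... | st' , run' , tr = st' , run' , halts⇒OutCode tr halts

theorem6p3 : (𝔭 𝔮 : ℕ → ℕ) → PrimeSeqs 𝔭 𝔮 →
    (n : ℕ) → (P : List (Instr n)) →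
    Σ[ Q ∈ Fractran ] (Regular Q ×
    ((xs : Vec ℕ n) → MMTerminates (1 , P) (1 , xs) ⇔ FTerminates Q (𝔭 1 * qEnc 𝔮 xs)))
theorem6p3 𝔭 𝔮 ps n P =
  compile , compileFrom-regular 1 P ,
  λ xs → ⇔-trans (MMTerminates⇔Terminates (1 , xs)) (Terminates⇔FTerminates (at 1 , xs))
  where
  open Simulation 𝔭 𝔮 ps
  open Machine P
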